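{- For all integers $n\geq k\geq 1$, $$\sum_{\pi\in P_{n,k}}\mathrm{sumelements}(\pi)=S_{n,k}\sum_{a=1}^{k}\frac{a(a-1)}{2}+\sum_{i=1}^{k-1}\left(\frac{(k-i)i(i+1)}{2}\sum_{j=1}^{n-k}S_{n-j,k}\,i^{j-1}\right),$$ where $S_{m,k}$ denotes the Stirling number of the second kind (an empty sum is $0$).
   Context: A set partition of $[n]$ with exactly $k$ blocks is a collection $\{B_1,\dots,B_k\}$ of nonempty pairwise disjoint subsets with union $[n]$, indexed so that $\min B_1<\cdots<\min B_k$; $P_{n,k}$ is the set of such partitions. A partition is identified with its canonical sequential form $\pi=\pi_1\cdots\pi_n$, where $i\in B_{\pi_i}$. An entry $\pi_i$ is a record if $\pi_i>\pi_j$ for all $j<i$; the records are the first occurrences of $1,\dots,k$. For $a\in[k]$, $\mathrm{sumelements}_a(\pi)$ is the sum of all entries of $\pi$ at positions strictly before the record $a$, and $\mathrm{sumelements}(\pi)=\sum_{a=1}^{k}\mathrm{sumelements}_a(\pi)$. For example, $\mathrm{sumelements}(121132)=1+(1+2+1+1)=6$. -}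

module Defs where

open import Data.Nat using (ℕ; zero; suc; _+_; _*_; _∸_; _^_; _⊔_; _<ᵇ_; _≤ᵇ_; _≡ᵇ_)
open import Data.Bool using (Bool; true; false; _∧_; if_then_else_)
open import Data.Nat.ListAction using (sum)
open import Data.List using (List; []; _∷_; map; upTo; filter; concatMap; length)
open import Data.Bool.Properties using (T?)

Σ[1…_] : ℕ → (ℕ → ℕ) → ℕ
Σ[1… n ] f = sum (map (λ i → f (suc i)) (upTo n))

S : ℕ → ℕ → ℕ
S zero    zero    = 1
S zero    (suc k) = 0
S (suc m) zero    = 0
S (suc m) (suc k) = suc k * S m (suc k) + S m k

words : ℕ → ℕ → List (List ℕ)
words zero    k = [] ∷ []
words (suc n) k = concatMap (λ w → map (λ a → suc a ∷ w) (upTo k)) (words n k)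

-- canonical sequential form of a partition with exactly k blocks:
-- each entry is ≥ 1 and at most 1 + (max of previous entries; 0 if none),
-- and the overall maximum equals k.
canonAux : ℕ → ℕ → List ℕ → Bool
canonAux k m []       = m ≡ᵇ k
canonAux k m (x ∷ xs) = (1 ≤ᵇ x) ∧ (x ≤ᵇ suc m) ∧ canonAux k (m ⊔ x) xs

isCanonical : ℕ → List ℕ → Bool
isCanonical k π = canonAux k 0 π

P : ℕ → ℕ → List (List ℕ)
P n k = filter (λ π → T? (isCanonical k π)) (words n k)

-- sumelements: for every record (entry strictly larger than all previous
-- entries), add the sum of all entries strictly before it.
-- m = max of previous entries (0 if none), s = sum of previous entries.
sumelAux : ℕ → ℕ → List ℕ → ℕ
sumelAux m s []       = 0
sumelAux m s (x ∷ xs) = (if m <ᵇ x then s else 0) + sumelAux (m ⊔ x) (s + x) xs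

sumelements : List ℕ → ℕ
sumelements π = sumelAux 0 0 π

{-# OPTIONS --safe #-}
module Submission where

open import Defs
open import Data.Nat using (ℕ; zero; suc; _+_; _*_; _∸_; _^_; _≤_; _<_; _/_; _⊔_; _<ᵇ_; _≤ᵇ_; _≡ᵇ_; s≤s; z<s; s<s)
open import Data.Nat.Properties
open import Data.Nat.DivMod using (m*n/n≡m)
open import Data.Nat.ListAction using (sum)
open import Data.Nat.ListAction.Properties using (sum-++)
open import Data.Nat.Tactic.RingSolver using (solve-∀)
open import Algebra.Properties.CommutativeSemigroup +-commutativeSemigroup using (interchange)
open import Data.Bool using (Bool; true; false; _∧_; _∨_; if_then_else_)
open import Data.Bool.Properties using (T?; T-≡; ∧-zeroʳ; ∧-identityʳ; ∨-identityʳ)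
open import Data.Empty using (⊥-elim)
open import Data.List using (List; []; _∷_; [_]; _++_; _∷ʳ_; map; upTo; applyUpTo; filter; concatMap)
open import Data.List.Properties using (map-++; map-cong; map-∘; map-upTo)
open import Function using (_∘_; Equivalence)
open import Relation.Binary.PropositionalEquality using (_≡_; refl; sym; trans; cong; cong₂; subst; module ≡-Reasoning)
open ≡-Reasoning

-- A word of P (n+1) (k+1) is a word of
-- P n (k+1) followed by one of the k+1 old letters, which is never a record, or a word of
-- P n k followed by the new letter k+1, which is a record preceded by the whole word.
-- Hence the totals F n k of sumelements and G n k of entry sums over P n k satisfy
--   F (n+1) (k+1) = (k+1) F n (k+1) + F n k + G n k,
--   G (n+1) (k+1) = (k+1) G n (k+1) + t (k+1) S n (k+1) + G n k + (k+1) S n k,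
-- with t i = i(i+1)/2.  The closed forms
--   G n k = t k S n k + Σ_{i=1}^{k} t i H n k i,   F n k = B k S n k + Σ_{i=1}^{k} (k-i) t i H n k i,
-- with B k = Σ_{a<k} t a, satisfy the same recurrences: H n k i obeys the recurrence of S n k,
-- and H n k (k+1) = S n (k+1) supplies the extra summand of G.

∑< : ℕ → (ℕ → ℕ) → ℕ
∑< n f = sum (applyUpTo f n)

syntax ∑< n (λ a → e) = ∑[ a < n ] e

∑<-cong : ∀ n {f g : ℕ → ℕ} → (∀ a → a < n → f a ≡ g a) → ∑< n f ≡ ∑< n g
∑<-cong zero    f≡g = refl
∑<-cong (suc n) f≡g = cong₂ _+_ (f≡g 0 z<s) (∑<-cong n (λ a a<n → f≡g (suc a) (s<s a<n)))

∑<-const : ∀ n c → ∑[ a < n ] c ≡ n * c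
∑<-const zero    c = refl
∑<-const (suc n) c = cong (c +_) (∑<-const n c)

∑<-zero : ∀ n → ∑[ a < n ] 0 ≡ 0
∑<-zero n = trans (∑<-const n 0) (*-zeroʳ n)

∑<-+ : ∀ n (f g : ℕ → ℕ) → ∑[ a < n ] (f a + g a) ≡ ∑< n f + ∑< n g
∑<-+ zero    f g = refl
∑<-+ (suc n) f g = begin
  f 0 + g 0 + ∑[ a < n ] (f (suc a) + g (suc a))  ≡⟨ cong (f 0 + g 0 +_) (∑<-+ n (f ∘ suc) (g ∘ suc)) ⟩
  f 0 + g 0 + (∑< n (f ∘ suc) + ∑< n (g ∘ suc))   ≡⟨ interchange (f 0) (g 0) _ _ ⟩
  f 0 + ∑< n (f ∘ suc) + (g 0 + ∑< n (g ∘ suc))   ∎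

∑<-*ˡ : ∀ n c (f : ℕ → ℕ) → ∑[ a < n ] (c * f a) ≡ c * ∑< n f
∑<-*ˡ zero    c f = sym (*-zeroʳ c)
∑<-*ˡ (suc n) c f = trans (cong (c * f 0 +_) (∑<-*ˡ n c (f ∘ suc))) (sym (*-distribˡ-+ c (f 0) _))

∑<-linear : ∀ m s {f : ℕ → ℕ} (g h : ℕ → ℕ) →
  (∀ a → a < m → f a ≡ s * g a + h a) → ∑< m f ≡ s * ∑< m g + ∑< m h
∑<-linear m s {f} g h f≡sg+h = begin
  ∑< m f                         ≡⟨ ∑<-cong m f≡sg+h ⟩
  ∑[ a < m ] (s * g a + h a)     ≡⟨ ∑<-+ m (λ a → s * g a) h ⟩
  ∑[ a < m ] (s * g a) + ∑< m h  ≡⟨ cong (_+ ∑< m h) (∑<-*ˡ m s g) ⟩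
  s * ∑< m g + ∑< m h            ∎

∑<-last : ∀ n f → ∑< (suc n) f ≡ ∑< n f + f n
∑<-last zero    f = +-identityʳ (f 0)
∑<-last (suc n) f = trans (cong (f 0 +_) (∑<-last n (f ∘ suc))) (sym (+-assoc (f 0) _ _))

∑<-comm : ∀ m n (F : ℕ → ℕ → ℕ) → ∑[ a < m ] ∑[ b < n ] F a b ≡ ∑[ b < n ] ∑[ a < m ] F a b
∑<-comm zero    n F = sym (∑<-zero n)
∑<-comm (suc m) n F = begin
  ∑< n (F 0) + ∑[ a < m ] ∑[ b < n ] F (suc a) b  ≡⟨ cong (∑< n (F 0) +_) (∑<-comm m n (F ∘ suc)) ⟩
  ∑< n (F 0) + ∑[ b < n ] ∑[ a < m ] F (suc a) b  ≡⟨ ∑<-+ n (F 0) _ ⟨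
  ∑[ b < n ] (F 0 b + ∑[ a < m ] F (suc a) b)     ∎

∑<-<ᵇ : ∀ {n j} (f : ℕ → ℕ) → j ≤ n → ∑[ a < n ] (if a <ᵇ j then f a else 0) ≡ ∑< j f
∑<-<ᵇ {n}     {zero}  f _         = ∑<-zero n
∑<-<ᵇ {suc n} {suc j} f (s≤s j≤n) = cong (f 0 +_) (∑<-<ᵇ (f ∘ suc) j≤n)

∑<-≡ᵇ : ∀ {n m} (f : ℕ → ℕ) → m < n → ∑[ a < n ] (if a ≡ᵇ m then f a else 0) ≡ f m
∑<-≡ᵇ {suc n} {zero}  f _         = trans (cong (f 0 +_) (∑<-zero n)) (+-identityʳ (f 0))
∑<-≡ᵇ {suc n} {suc m} f (s<s m<n) = ∑<-≡ᵇ (f ∘ suc) m<n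

∑<-countdown : ∀ k g → ∑[ a < suc k ] ((k ∸ a) * g a) ≡ ∑[ a < k ] ((k ∸ suc a) * g a) + ∑< k g
∑<-countdown zero    g = refl
∑<-countdown (suc k) g = begin
  suc k * g 0 + ∑[ a < suc k ] ((k ∸ a) * g (suc a))
    ≡⟨ cong (suc k * g 0 +_) (∑<-countdown k (g ∘ suc)) ⟩
  suc k * g 0 + (∑[ a < k ] ((k ∸ suc a) * g (suc a)) + ∑< k (g ∘ suc))
    ≡⟨ split-head k (g 0) _ _ ⟩
  k * g 0 + ∑[ a < k ] ((k ∸ suc a) * g (suc a)) + (g 0 + ∑< k (g ∘ suc)) ∎
  where
  split-head : ∀ k x y z → suc k * x + (y + z) ≡ k * x + y + (x + z)
  split-head = solve-∀

Σ[1…]-as-∑< : ∀ n f → Σ[1… n ] f ≡ ∑[ a < n ] f (suc a)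
Σ[1…]-as-∑< n f = cong sum (map-upTo (f ∘ suc) n)

module _ {A : Set} where

  sumMap : (A → ℕ) → List A → ℕ
  sumMap f xs = sum (map f xs)

  sumMap-cong : ∀ {f g : A → ℕ} xs → (∀ x → f x ≡ g x) → sumMap f xs ≡ sumMap g xs
  sumMap-cong xs f≡g = cong sum (map-cong f≡g xs)

  sumMap-zero : ∀ (xs : List A) → sumMap (λ _ → 0) xs ≡ 0
  sumMap-zero []       = refl
  sumMap-zero (x ∷ xs) = sumMap-zero xs

  sumMap-+ : ∀ (f g : A → ℕ) xs → sumMap (λ x → f x + g x) xs ≡ sumMap f xs + sumMap g xs
  sumMap-+ f g []       = refl
  sumMap-+ f g (x ∷ xs) = trans (cong (f x + g x +_) (sumMap-+ f g xs)) (interchange (f x) (g x) _ _)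

  sumMap-*ˡ : ∀ c (f : A → ℕ) xs → sumMap (λ x → c * f x) xs ≡ c * sumMap f xs
  sumMap-*ˡ c f []       = sym (*-zeroʳ c)
  sumMap-*ˡ c f (x ∷ xs) = trans (cong (c * f x +_) (sumMap-*ˡ c f xs)) (sym (*-distribˡ-+ c (f x) _))

  sumMap-++ : ∀ (f : A → ℕ) xs ys → sumMap f (xs ++ ys) ≡ sumMap f xs + sumMap f ys
  sumMap-++ f xs ys = trans (cong sum (map-++ f xs ys)) (sum-++ (map f xs) (map f ys))

  sumMap-filter : ∀ (p : A → Bool) (f : A → ℕ) xs →
    sumMap f (filter (T? ∘ p) xs) ≡ sumMap (λ x → if p x then f x else 0) xs
  sumMap-filter p f []       = refl
  sumMap-filter p f (x ∷ xs) with p x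
  ... | true  = cong (f x +_) (sumMap-filter p f xs)
  ... | false = sumMap-filter p f xs

sumMap-concatMap : ∀ {A B : Set} (f : B → ℕ) (g : A → List B) xs →
  sumMap f (concatMap g xs) ≡ sumMap (sumMap f ∘ g) xs
sumMap-concatMap f g []       = refl
sumMap-concatMap f g (x ∷ xs) =
  trans (sumMap-++ f (g x) (concatMap g xs)) (cong (sumMap f (g x) +_) (sumMap-concatMap f g xs))

sumMap-words-∷ : ∀ n K (h : List ℕ → ℕ) →
  sumMap h (words (suc n) K) ≡ sumMap (λ w → ∑[ a < K ] h (suc a ∷ w)) (words n K)
sumMap-words-∷ n K h = trans (sumMap-concatMap h _ (words n K)) (sumMap-cong (words n K) letters)
  where
  letters : ∀ w → sumMap h (map (λ a → suc a ∷ w) (upTo K)) ≡ ∑[ a < K ] h (suc a ∷ w)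
  letters w = cong sum (trans (sym (map-∘ (upTo K))) (map-upTo _ K))

sumMap-words-∷ʳ : ∀ n K (h : List ℕ → ℕ) →
  sumMap h (words (suc n) K) ≡ sumMap (λ w → ∑[ a < K ] h (w ∷ʳ suc a)) (words n K)
sumMap-words-∷ʳ zero    K h = sumMap-words-∷ zero K h
sumMap-words-∷ʳ (suc n) K h = begin
  sumMap h (words (suc (suc n)) K)
    ≡⟨ sumMap-words-∷ (suc n) K h ⟩
  sumMap (λ v → ∑[ a < K ] h (suc a ∷ v)) (words (suc n) K)
    ≡⟨ sumMap-words-∷ʳ n K _ ⟩
  sumMap (λ w → ∑[ b < K ] ∑[ a < K ] h (suc a ∷ (w ∷ʳ suc b))) (words n K)
    ≡⟨ sumMap-cong (words n K) (λ w → ∑<-comm K K (λ b a → h (suc a ∷ (w ∷ʳ suc b)))) ⟩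
  sumMap (λ w → ∑[ a < K ] ∑[ b < K ] h (suc a ∷ (w ∷ʳ suc b))) (words n K)
    ≡⟨ sumMap-words-∷ n K _ ⟨
  sumMap (λ v → ∑[ b < K ] h (v ∷ʳ suc b)) (words (suc n) K) ∎

runningMax : ℕ → List ℕ → ℕ
runningMax m []       = m
runningMax m (x ∷ xs) = runningMax (m ⊔ x) xs

restrictedGrowth : ℕ → List ℕ → Bool
restrictedGrowth m []       = true
restrictedGrowth m (x ∷ xs) = (1 ≤ᵇ x) ∧ (x ≤ᵇ suc m) ∧ restrictedGrowth (m ⊔ x) xs

canonAux-split : ∀ k m w → canonAux k m w ≡ restrictedGrowth m w ∧ (runningMax m w ≡ᵇ k)
canonAux-split k m []       = refl
canonAux-split k m (x ∷ xs) with 1 ≤ᵇ x | x ≤ᵇ suc m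
... | false | _     = refl
... | true  | false = refl
... | true  | true  = canonAux-split k (m ⊔ x) xs

canonAux-∷ʳ : ∀ k m w x → canonAux k m (w ∷ʳ x)
  ≡ restrictedGrowth m w ∧ (1 ≤ᵇ x) ∧ (x ≤ᵇ suc (runningMax m w)) ∧ (runningMax m w ⊔ x ≡ᵇ k)
canonAux-∷ʳ k m []       x = refl
canonAux-∷ʳ k m (y ∷ ys) x with 1 ≤ᵇ y | y ≤ᵇ suc m
... | false | _     = refl
... | true  | false = refl
... | true  | true  = canonAux-∷ʳ k (m ⊔ y) ys x

isCanonical-split : ∀ k w → isCanonical k w ≡ restrictedGrowth 0 w ∧ (runningMax 0 w ≡ᵇ k)
isCanonical-split k = canonAux-split k 0

isCanonical-∷ʳ : ∀ k w x → isCanonical k (w ∷ʳ x)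
  ≡ restrictedGrowth 0 w ∧ (1 ≤ᵇ x) ∧ (x ≤ᵇ suc (runningMax 0 w)) ∧ (runningMax 0 w ⊔ x ≡ᵇ k)
isCanonical-∷ʳ k = canonAux-∷ʳ k 0

sum-∷ʳ : ∀ w x → sum (w ∷ʳ x) ≡ sum w + x
sum-∷ʳ w x = trans (sum-++ w [ x ]) (cong (sum w +_) (+-identityʳ x))

sumelAux-∷ʳ : ∀ m s w x →
  sumelAux m s (w ∷ʳ x) ≡ sumelAux m s w + (if runningMax m w <ᵇ x then s + sum w else 0)
sumelAux-∷ʳ m s [] x with m <ᵇ x
... | true  = refl
... | false = refl
sumelAux-∷ʳ m s (y ∷ ys) x = begin
  r + sumelAux (m ⊔ y) (s + y) (ys ∷ʳ x)
    ≡⟨ cong (r +_) (sumelAux-∷ʳ (m ⊔ y) (s + y) ys x) ⟩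
  r + (sumelAux (m ⊔ y) (s + y) ys + (if b then s + y + sum ys else 0))
    ≡⟨ +-assoc r _ _ ⟨
  r + sumelAux (m ⊔ y) (s + y) ys + (if b then s + y + sum ys else 0)
    ≡⟨ cong (λ z → r + sumelAux (m ⊔ y) (s + y) ys + (if b then z else 0)) (+-assoc s y (sum ys)) ⟩
  r + sumelAux (m ⊔ y) (s + y) ys + (if b then s + (y + sum ys) else 0) ∎
  where
  r = if m <ᵇ y then s else 0
  b = runningMax (m ⊔ y) ys <ᵇ x

<ᵇ-false : ∀ {m n} → n ≤ m → (m <ᵇ n) ≡ false
<ᵇ-false {m}     {zero}  _         = refl
<ᵇ-false {suc m} {suc n} (s≤s n≤m) = <ᵇ-false n≤m

<ᵇ-true : ∀ {m n} → m < n → (m <ᵇ n) ≡ true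
<ᵇ-true m<n = Equivalence.to T-≡ (<⇒<ᵇ m<n)

sumelements-∷ʳ-nonrecord : ∀ w x → x ≤ runningMax 0 w → sumelements (w ∷ʳ x) ≡ sumelements w
sumelements-∷ʳ-nonrecord w x x≤max rewrite sumelAux-∷ʳ 0 0 w x | <ᵇ-false x≤max = +-identityʳ _

sumelements-∷ʳ-record : ∀ w x → runningMax 0 w < x → sumelements (w ∷ʳ x) ≡ sumelements w + sum w
sumelements-∷ʳ-record w x max<x rewrite sumelAux-∷ʳ 0 0 w x | <ᵇ-true max<x = refl

≡ᵇ-true⇒≡ : ∀ {m n} → (m ≡ᵇ n) ≡ true → m ≡ n
≡ᵇ-true⇒≡ {m} {n} eq = ≡ᵇ⇒≡ m n (Equivalence.from T-≡ eq)

extend-max≡ᵇ : ∀ M j a → (a <ᵇ suc M) ∧ (M ⊔ suc a ≡ᵇ j) ≡ (M ≡ᵇ j) ∧ (a <ᵇ j) ∨ (suc M ≡ᵇ j) ∧ (a ≡ᵇ M)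
extend-max≡ᵇ zero    zero    a       = ∧-zeroʳ _
extend-max≡ᵇ (suc M) zero    a       = ∧-zeroʳ _
extend-max≡ᵇ zero    (suc j) zero    = sym (∧-identityʳ _)
extend-max≡ᵇ (suc M) (suc j) zero    = begin
  M ⊔ 0 ≡ᵇ j                              ≡⟨ cong (_≡ᵇ j) (⊔-identityʳ M) ⟩
  M ≡ᵇ j                                  ≡⟨ ∨-identityʳ _ ⟨
  (M ≡ᵇ j) ∨ false                        ≡⟨ cong₂ _∨_ (∧-identityʳ _) (∧-zeroʳ _) ⟨
  (M ≡ᵇ j) ∧ true ∨ (suc M ≡ᵇ j) ∧ false  ∎
extend-max≡ᵇ zero    (suc j) (suc a) = sym (∧-zeroʳ _)
extend-max≡ᵇ (suc M) (suc j) (suc a) = extend-max≡ᵇ M j a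

∑<-old-or-new : ∀ {K} M j (h : ℕ → ℕ) → j < K →
  ∑[ a < K ] (if (M ≡ᵇ suc j) ∧ (a <ᵇ suc j) ∨ (M ≡ᵇ j) ∧ (a ≡ᵇ M) then h a else 0)
  ≡ (if M ≡ᵇ suc j then ∑< (suc j) h else 0) + (if M ≡ᵇ j then h j else 0)
∑<-old-or-new {K} M j h j<K with M ≡ᵇ suc j in M≡1+j | M ≡ᵇ j in M≡j
... | true  | true  = ⊥-elim (1+n≢n (trans (sym (≡ᵇ-true⇒≡ {M} M≡1+j)) (≡ᵇ-true⇒≡ {M} M≡j)))
... | true  | false = begin
  ∑[ a < K ] (if (a <ᵇ suc j) ∨ false then h a else 0)
    ≡⟨ ∑<-cong K (λ a _ → cong (λ b → if b then h a else 0) (∨-identityʳ (a <ᵇ suc j))) ⟩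
  ∑[ a < K ] (if a <ᵇ suc j then h a else 0)
    ≡⟨ ∑<-<ᵇ h j<K ⟩
  ∑< (suc j) h
    ≡⟨ +-identityʳ _ ⟨
  ∑< (suc j) h + 0 ∎
... | false | false = ∑<-zero K
... | false | true  with ≡ᵇ-true⇒≡ {M} {j} M≡j
... | refl = ∑<-≡ᵇ h j<K

∑<-isCanonical-∷ʳ : ∀ {K j} → j < K → (φ : List ℕ → ℕ) (w : List ℕ) →
  ∑[ a < K ] (if isCanonical (suc j) (w ∷ʳ suc a) then φ (w ∷ʳ suc a) else 0)
  ≡ (if isCanonical (suc j) w then ∑[ a < suc j ] φ (w ∷ʳ suc a) else 0)
    + (if isCanonical j w then φ (w ∷ʳ suc j) else 0)
∑<-isCanonical-∷ʳ {K} {j} j<K φ w rewrite isCanonical-split (suc j) w | isCanonical-split j w =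
  trans (∑<-cong K (λ a _ → cong (λ b → if b then φ (w ∷ʳ suc a) else 0) (isCanonical-∷ʳ (suc j) w (suc a))))
        (growth (restrictedGrowth 0 w))
  where
  M = runningMax 0 w
  growth : ∀ g →
    ∑[ a < K ] (if g ∧ (a <ᵇ suc M) ∧ (M ⊔ suc a ≡ᵇ suc j) then φ (w ∷ʳ suc a) else 0)
    ≡ (if g ∧ (M ≡ᵇ suc j) then ∑[ a < suc j ] φ (w ∷ʳ suc a) else 0)
      + (if g ∧ (M ≡ᵇ j) then φ (w ∷ʳ suc j) else 0)
  growth false = ∑<-zero K
  growth true  = trans (∑<-cong K (λ a _ → cong (λ b → if b then φ (w ∷ʳ suc a) else 0) (extend-max≡ᵇ M (suc j) a)))
                       (∑<-old-or-new M j (λ a → φ (w ∷ʳ suc a)) j<K)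

triangular : ℕ → ℕ
triangular zero    = 0
triangular (suc n) = triangular n + suc n

tetrahedral : ℕ → ℕ
tetrahedral n = ∑[ a < n ] triangular a

∑<-suc : ∀ n → ∑[ a < n ] suc a ≡ triangular n
∑<-suc zero    = refl
∑<-suc (suc n) = trans (∑<-last n suc) (cong (_+ suc n) (∑<-suc n))

triangular-*2 : ∀ n → triangular n * 2 ≡ n * suc n
triangular-*2 zero    = refl
triangular-*2 (suc n) = begin
  (triangular n + suc n) * 2    ≡⟨ *-distribʳ-+ 2 (triangular n) (suc n) ⟩
  triangular n * 2 + suc n * 2  ≡⟨ cong (_+ suc n * 2) (triangular-*2 n) ⟩
  n * suc n + suc n * 2         ≡⟨ expand n ⟩
  suc n * suc (suc n)           ∎
  where
  expand : ∀ n → n * suc n + suc n * 2 ≡ suc n * suc (suc n)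
  expand = solve-∀

halve : ∀ {x} y → x ≡ y * 2 → x / 2 ≡ y
halve y x≡2y = trans (cong (_/ 2) x≡2y) (m*n/n≡m y 2)

S-vanish : ∀ {m k} → m < k → S m k ≡ 0
S-vanish {zero}  {suc k} _         = refl
S-vanish {suc m} {suc k} (s<s m<k) = begin
  suc k * S m (suc k) + S m k  ≡⟨ cong₂ (λ x y → suc k * x + y) (S-vanish (m<n⇒m<1+n m<k)) (S-vanish m<k) ⟩
  suc k * 0 + 0                ≡⟨ cong (_+ 0) (*-zeroʳ (suc k)) ⟩
  0                            ∎

-- H n k i = ∑_{j=1}^{n} S (n - j) k * i ^ (j - 1)
H : ℕ → ℕ → ℕ → ℕ
H zero    k i = 0
H (suc n) k i = S n k + i * H n k i

H-vanish : ∀ {n k} i → n ≤ k → H n k i ≡ 0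
H-vanish {zero}      i _   = refl
H-vanish {suc n} {k} i n<k = begin
  S n k + i * H n k i  ≡⟨ cong₂ (λ x y → x + i * y) (S-vanish n<k) (H-vanish i (<⇒≤ n<k)) ⟩
  i * 0                ≡⟨ *-zeroʳ i ⟩
  0                    ∎

H-rec : ∀ n k i → H (suc n) (suc k) i ≡ suc k * H n (suc k) i + H n k i
H-rec zero    k i = trans (*-zeroʳ i) (sym (cong (_+ 0) (*-zeroʳ k)))
H-rec (suc n) k i = begin
  S (suc n) (suc k) + i * H (suc n) (suc k) i
    ≡⟨ cong (λ z → S (suc n) (suc k) + i * z) (H-rec n k i) ⟩
  suc k * S n (suc k) + S n k + i * (suc k * H n (suc k) i + H n k i)
    ≡⟨ regroup (suc k) (S n (suc k)) (S n k) i _ _ ⟩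
  suc k * (S n (suc k) + i * H n (suc k) i) + (S n k + i * H n k i) ∎
  where
  regroup : ∀ s x y i u v → s * x + y + i * (s * u + v) ≡ s * (x + i * u) + (y + i * v)
  regroup = solve-∀

H-diag : ∀ n k → H n k (suc k) ≡ S n (suc k)
H-diag zero    k = refl
H-diag (suc n) k = trans (cong (λ z → S n k + suc k * z) (H-diag n k)) (+-comm (S n k) _)

H-closed : ∀ d k i → H (d + k) k i ≡ ∑[ a < d ] (S (d + k ∸ suc a) k * i ^ a)
H-closed zero    k i = H-vanish {k} i ≤-refl
H-closed (suc d) k i = cong₂ _+_ (sym (*-identityʳ _)) (begin
  i * H (d + k) k i
    ≡⟨ cong (i *_) (H-closed d k i) ⟩
  i * ∑[ a < d ] (S (d + k ∸ suc a) k * i ^ a)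
    ≡⟨ ∑<-*ˡ d i _ ⟨
  ∑[ a < d ] (i * (S (d + k ∸ suc a) k * i ^ a))
    ≡⟨ ∑<-cong d (λ a _ → x*[y*z]≡y*[x*z] i (S (d + k ∸ suc a) k) (i ^ a)) ⟩
  ∑[ a < d ] (S (d + k ∸ suc a) k * (i * i ^ a)) ∎)
  where
  x*[y*z]≡y*[x*z] : ∀ x y z → x * (y * z) ≡ y * (x * z)
  x*[y*z]≡y*[x*z] = solve-∀

H-as-Σ : ∀ {n k} i → k ≤ n → H n k i ≡ Σ[1… n ∸ k ] (λ j → S (n ∸ j) k * i ^ (j ∸ 1))
H-as-Σ {n} {k} i k≤n = begin
  H n k i
    ≡⟨ subst (λ x → H x k i ≡ ∑[ a < x ∸ k ] (S (x ∸ suc a) k * i ^ a)) (m∸n+n≡m k≤n)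
             (trans (H-closed (n ∸ k) k i)
                    (cong (λ d → ∑[ a < d ] (S (n ∸ k + k ∸ suc a) k * i ^ a)) (sym (m+n∸n≡m (n ∸ k) k)))) ⟩
  ∑[ a < n ∸ k ] (S (n ∸ suc a) k * i ^ a)
    ≡⟨ Σ[1…]-as-∑< (n ∸ k) (λ j → S (n ∸ j) k * i ^ (j ∸ 1)) ⟨
  Σ[1… n ∸ k ] (λ j → S (n ∸ j) k * i ^ (j ∸ 1)) ∎

tH : ℕ → ℕ → ℕ → ℕ
tH n k i = triangular i * H n k i

G : ℕ → ℕ → ℕ
G n k = triangular k * S n k + ∑[ a < k ] tH n k (suc a)

F : ℕ → ℕ → ℕ
F n k = tetrahedral k * S n k + ∑[ a < k ] ((k ∸ suc a) * tH n k (suc a))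

G-empty : ∀ k → G 0 (suc k) ≡ 0
G-empty k = cong₂ _+_ (*-zeroʳ (triangular (suc k)))
                      (trans (∑<-cong (suc k) (λ a _ → *-zeroʳ (triangular (suc a)))) (∑<-zero (suc k)))

F-empty : ∀ k → F 0 (suc k) ≡ 0
F-empty k = cong₂ _+_ (*-zeroʳ (tetrahedral (suc k)))
                      (trans (∑<-cong (suc k) (λ a _ → trans (cong ((k ∸ a) *_) (*-zeroʳ (triangular (suc a))))
                                                             (*-zeroʳ (k ∸ a))))
                             (∑<-zero (suc k)))

x*[s*u+v]≡s*[x*u]+x*v : ∀ x s u v → x * (s * u + v) ≡ s * (x * u) + x * v
x*[s*u+v]≡s*[x*u]+x*v = solve-∀

tH-rec : ∀ n k i → tH (suc n) (suc k) i ≡ suc k * tH n (suc k) i + tH n k i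
tH-rec n k i = trans (cong (triangular i *_) (H-rec n k i)) (x*[s*u+v]≡s*[x*u]+x*v (triangular i) (suc k) _ _)

G-rec : ∀ n k → G (suc n) (suc k) ≡ suc k * G n (suc k) + triangular (suc k) * S n (suc k) + (G n k + suc k * S n k)
G-rec n k = begin
  t′ * S (suc n) (suc k) + ∑[ a < suc k ] tH (suc n) (suc k) (suc a)
    ≡⟨ cong (t′ * S (suc n) (suc k) +_)
            (∑<-linear (suc k) (suc k) (λ a → tH n (suc k) (suc a)) (λ a → tH n k (suc a)) (λ a _ → tH-rec n k (suc a))) ⟩
  t′ * S (suc n) (suc k) + (suc k * X + ∑[ a < suc k ] tH n k (suc a))
    ≡⟨ cong (λ z → t′ * S (suc n) (suc k) + (suc k * X + z)) (∑<-last k (λ a → tH n k (suc a))) ⟩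
  t′ * S (suc n) (suc k) + (suc k * X + (Y + tH n k (suc k)))
    ≡⟨ cong (λ z → t′ * S (suc n) (suc k) + (suc k * X + (Y + t′ * z))) (H-diag n k) ⟩
  t′ * S (suc n) (suc k) + (suc k * X + (Y + t′ * S n (suc k)))
    ≡⟨ regroup (triangular k) (suc k) (S n (suc k)) (S n k) X Y ⟩
  suc k * (t′ * S n (suc k) + X) + t′ * S n (suc k) + (triangular k * S n k + Y + suc k * S n k) ∎
  where
  t′ = triangular (suc k)
  X = ∑[ a < suc k ] tH n (suc k) (suc a)
  Y = ∑[ a < k ] tH n k (suc a)
  regroup : ∀ t s x y X Y → (t + s) * (s * x + y) + (s * X + (Y + (t + s) * x))
                           ≡ s * ((t + s) * x + X) + (t + s) * x + (t * y + Y + s * y)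
  regroup = solve-∀

F-rec : ∀ n k → F (suc n) (suc k) ≡ suc k * F n (suc k) + (F n k + G n k)
F-rec n k = begin
  b′ * S (suc n) (suc k) + ∑[ a < suc k ] ((k ∸ a) * tH (suc n) (suc k) (suc a))
    ≡⟨ cong (b′ * S (suc n) (suc k) +_)
            (∑<-linear (suc k) (suc k) (λ a → (k ∸ a) * tH n (suc k) (suc a)) (λ a → (k ∸ a) * tH n k (suc a)) λ a _ →
               trans (cong ((k ∸ a) *_) (tH-rec n k (suc a)))
                     (x*[s*u+v]≡s*[x*u]+x*v (k ∸ a) (suc k) (tH n (suc k) (suc a)) (tH n k (suc a)))) ⟩
  b′ * S (suc n) (suc k) + (suc k * R + ∑[ a < suc k ] ((k ∸ a) * tH n k (suc a)))
    ≡⟨ cong (λ z → b′ * S (suc n) (suc k) + (suc k * R + z)) (∑<-countdown k (λ a → tH n k (suc a))) ⟩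
  b′ * S (suc n) (suc k) + (suc k * R + (Q + Y))
    ≡⟨ regroup b′ (suc k) (S n (suc k)) (S n k) R Q Y ⟩
  suc k * F n (suc k) + (b′ * S n k + Q + Y)
    ≡⟨ cong (λ b → suc k * F n (suc k) + (b * S n k + Q + Y)) (∑<-last k triangular) ⟩
  suc k * F n (suc k) + ((tetrahedral k + triangular k) * S n k + Q + Y)
    ≡⟨ cong (suc k * F n (suc k) +_) (regroup₂ (tetrahedral k) (triangular k) (S n k) Q Y) ⟩
  suc k * F n (suc k) + (F n k + G n k) ∎
  where
  b′ = tetrahedral (suc k)
  R = ∑[ a < suc k ] ((k ∸ a) * tH n (suc k) (suc a))
  Q = ∑[ a < k ] ((k ∸ suc a) * tH n k (suc a))
  Y = ∑[ a < k ] tH n k (suc a)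
  regroup : ∀ b s x y R Q Y → b * (s * x + y) + (s * R + (Q + Y)) ≡ s * (b * x + R) + (b * y + Q + Y)
  regroup = solve-∀
  regroup₂ : ∀ b t y Q Y → (b + t) * y + Q + Y ≡ b * y + Q + (t * y + Y)
  regroup₂ = solve-∀

∑<-sum-∷ʳ : ∀ m w → ∑[ a < m ] sum (w ∷ʳ suc a) ≡ m * sum w + triangular m
∑<-sum-∷ʳ m w = begin
  ∑[ a < m ] sum (w ∷ʳ suc a)          ≡⟨ ∑<-cong m (λ a _ → sum-∷ʳ w (suc a)) ⟩
  ∑[ a < m ] (sum w + suc a)           ≡⟨ ∑<-+ m (λ _ → sum w) suc ⟩
  ∑[ a < m ] sum w + ∑[ a < m ] suc a  ≡⟨ cong₂ _+_ (∑<-const m (sum w)) (∑<-suc m) ⟩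
  m * sum w + triangular m             ∎

-- Words range over a fixed alphabet [K] so that j can vary in the recursion:
-- for j ≤ K, ∑P n j φ is the sum of φ over P n j.
module CanonicalSums (K : ℕ) where

  ∑P : ℕ → ℕ → (List ℕ → ℕ) → ℕ
  ∑P n j φ = sumMap (λ w → if isCanonical j w then φ w else 0) (words n K)

  ∑P-cong : ∀ n j {φ ψ : List ℕ → ℕ} → (∀ w → runningMax 0 w ≡ j → φ w ≡ ψ w) → ∑P n j φ ≡ ∑P n j ψ
  ∑P-cong n j {φ} {ψ} φ≡ψ = sumMap-cong (words n K) on-canonical
    where
    on-canonical : ∀ w → (if isCanonical j w then φ w else 0) ≡ (if isCanonical j w then ψ w else 0)
    on-canonical w rewrite isCanonical-split j w with restrictedGrowth 0 w | runningMax 0 w ≡ᵇ j in max≡j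
    ... | false | _     = refl
    ... | true  | false = refl
    ... | true  | true  = φ≡ψ w (≡ᵇ-true⇒≡ {runningMax 0 w} max≡j)

  ∑P-+ : ∀ n j (φ ψ : List ℕ → ℕ) → ∑P n j (λ w → φ w + ψ w) ≡ ∑P n j φ + ∑P n j ψ
  ∑P-+ n j φ ψ = trans (sumMap-cong (words n K) split) (sumMap-+ _ _ (words n K))
    where
    split : ∀ w → (if isCanonical j w then φ w + ψ w else 0)
                ≡ (if isCanonical j w then φ w else 0) + (if isCanonical j w then ψ w else 0)
    split w with isCanonical j w
    ... | true  = refl
    ... | false = refl

  ∑P-*ˡ : ∀ n j c (φ : List ℕ → ℕ) → ∑P n j (λ w → c * φ w) ≡ c * ∑P n j φ
  ∑P-*ˡ n j c φ = trans (sumMap-cong (words n K) scale) (sumMap-*ˡ c _ (words n K))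
    where
    scale : ∀ w → (if isCanonical j w then c * φ w else 0) ≡ c * (if isCanonical j w then φ w else 0)
    scale w with isCanonical j w
    ... | true  = refl
    ... | false = sym (*-zeroʳ c)

  ∑P-empty : ∀ n φ → ∑P (suc n) 0 φ ≡ 0
  ∑P-empty n φ = begin
    ∑P (suc n) 0 φ
      ≡⟨ sumMap-words-∷ʳ n K _ ⟩
    sumMap (λ w → ∑[ a < K ] (if isCanonical 0 (w ∷ʳ suc a) then φ (w ∷ʳ suc a) else 0)) (words n K)
      ≡⟨ sumMap-cong (words n K) (λ w → trans (∑<-cong K (λ a _ → not-canonical w a)) (∑<-zero K)) ⟩
    sumMap (λ _ → 0) (words n K)
      ≡⟨ sumMap-zero (words n K) ⟩
    0 ∎
    where
    max-nonzero : ∀ m a → (m ⊔ suc a ≡ᵇ 0) ≡ false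
    max-nonzero zero    a = refl
    max-nonzero (suc m) a = refl
    not-canonical : ∀ w a → (if isCanonical 0 (w ∷ʳ suc a) then φ (w ∷ʳ suc a) else 0) ≡ 0
    not-canonical w a rewrite isCanonical-∷ʳ 0 w (suc a) | max-nonzero (runningMax 0 w) a
                            | ∧-zeroʳ (a <ᵇ suc (runningMax 0 w)) | ∧-zeroʳ (restrictedGrowth 0 w) = refl

  ∑P-∷ʳ : ∀ n j (φ : List ℕ → ℕ) → j < K →
    ∑P (suc n) (suc j) φ ≡ ∑P n (suc j) (λ w → ∑[ a < suc j ] φ (w ∷ʳ suc a)) + ∑P n j (λ w → φ (w ∷ʳ suc j))
  ∑P-∷ʳ n j φ j<K = begin
    ∑P (suc n) (suc j) φ
      ≡⟨ sumMap-words-∷ʳ n K _ ⟩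
    sumMap (λ w → ∑[ a < K ] (if isCanonical (suc j) (w ∷ʳ suc a) then φ (w ∷ʳ suc a) else 0)) (words n K)
      ≡⟨ sumMap-cong (words n K) (∑<-isCanonical-∷ʳ j<K φ) ⟩
    sumMap (λ w → (if isCanonical (suc j) w then ∑[ a < suc j ] φ (w ∷ʳ suc a) else 0)
                  + (if isCanonical j w then φ (w ∷ʳ suc j) else 0)) (words n K)
      ≡⟨ sumMap-+ _ _ (words n K) ⟩
    ∑P n (suc j) (λ w → ∑[ a < suc j ] φ (w ∷ʳ suc a)) + ∑P n j (λ w → φ (w ∷ʳ suc j)) ∎

  ∑P-const : ∀ n j c → j ≤ K → ∑P n j (λ _ → c) ≡ c * S n j
  ∑P-const zero    zero    c _   = trans (+-identityʳ c) (sym (*-identityʳ c))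
  ∑P-const zero    (suc j) c _   = sym (*-zeroʳ c)
  ∑P-const (suc n) zero    c _   = trans (∑P-empty n _) (sym (*-zeroʳ c))
  ∑P-const (suc n) (suc j) c j<K = begin
    ∑P (suc n) (suc j) (λ _ → c)
      ≡⟨ ∑P-∷ʳ n j _ j<K ⟩
    ∑P n (suc j) (λ _ → ∑[ a < suc j ] c) + ∑P n j (λ _ → c)
      ≡⟨ cong₂ _+_ (∑P-const n (suc j) _ j<K) (∑P-const n j c (<⇒≤ j<K)) ⟩
    ∑[ a < suc j ] c * S n (suc j) + c * S n j
      ≡⟨ cong (λ x → x * S n (suc j) + c * S n j) (∑<-const (suc j) c) ⟩
    suc j * c * S n (suc j) + c * S n j
      ≡⟨ factor (suc j) c (S n (suc j)) (S n j) ⟩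
    c * (suc j * S n (suc j) + S n j) ∎
    where
    factor : ∀ s c x y → s * c * x + c * y ≡ c * (s * x + y)
    factor = solve-∀

  ∑P-sum-∷ʳ : ∀ n j → j < K → ∑P (suc n) (suc j) sum
    ≡ suc j * ∑P n (suc j) sum + triangular (suc j) * S n (suc j) + (∑P n j sum + suc j * S n j)
  ∑P-sum-∷ʳ n j j<K = begin
    ∑P (suc n) (suc j) sum
      ≡⟨ ∑P-∷ʳ n j sum j<K ⟩
    ∑P n (suc j) (λ w → ∑[ a < suc j ] sum (w ∷ʳ suc a)) + ∑P n j (λ w → sum (w ∷ʳ suc j))
      ≡⟨ cong₂ _+_ (∑P-cong n (suc j) (λ w _ → ∑<-sum-∷ʳ (suc j) w)) (∑P-cong n j (λ w _ → sum-∷ʳ w (suc j))) ⟩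
    ∑P n (suc j) (λ w → suc j * sum w + triangular (suc j)) + ∑P n j (λ w → sum w + suc j)
      ≡⟨ cong₂ _+_ (∑P-+ n (suc j) _ _) (∑P-+ n j sum _) ⟩
    ∑P n (suc j) (λ w → suc j * sum w) + ∑P n (suc j) (λ _ → triangular (suc j)) + (∑P n j sum + ∑P n j (λ _ → suc j))
      ≡⟨ cong₂ (λ x y → x + y + (∑P n j sum + ∑P n j (λ _ → suc j)))
               (∑P-*ˡ n (suc j) (suc j) sum) (∑P-const n (suc j) (triangular (suc j)) j<K) ⟩
    suc j * ∑P n (suc j) sum + triangular (suc j) * S n (suc j) + (∑P n j sum + ∑P n j (λ _ → suc j))
      ≡⟨ cong (λ z → suc j * ∑P n (suc j) sum + triangular (suc j) * S n (suc j) + (∑P n j sum + z))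
              (∑P-const n j (suc j) (<⇒≤ j<K)) ⟩
    suc j * ∑P n (suc j) sum + triangular (suc j) * S n (suc j) + (∑P n j sum + suc j * S n j) ∎

  ∑P-sumelements-∷ʳ : ∀ n j → j < K → ∑P (suc n) (suc j) sumelements
    ≡ suc j * ∑P n (suc j) sumelements + (∑P n j sumelements + ∑P n j sum)
  ∑P-sumelements-∷ʳ n j j<K = begin
    ∑P (suc n) (suc j) sumelements
      ≡⟨ ∑P-∷ʳ n j sumelements j<K ⟩
    ∑P n (suc j) (λ w → ∑[ a < suc j ] sumelements (w ∷ʳ suc a)) + ∑P n j (λ w → sumelements (w ∷ʳ suc j))
      ≡⟨ cong₂ _+_ (trans (∑P-cong n (suc j) old-letters) (∑P-*ˡ n (suc j) (suc j) sumelements))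
                   (trans (∑P-cong n j new-letter) (∑P-+ n j sumelements sum)) ⟩
    suc j * ∑P n (suc j) sumelements + (∑P n j sumelements + ∑P n j sum) ∎
    where
    old-letters : ∀ w → runningMax 0 w ≡ suc j → ∑[ a < suc j ] sumelements (w ∷ʳ suc a) ≡ suc j * sumelements w
    old-letters w max≡1+j = trans
      (∑<-cong (suc j) (λ a a<1+j → sumelements-∷ʳ-nonrecord w (suc a) (subst (suc a ≤_) (sym max≡1+j) a<1+j)))
      (∑<-const (suc j) (sumelements w))
    new-letter : ∀ w → runningMax 0 w ≡ j → sumelements (w ∷ʳ suc j) ≡ sumelements w + sum w
    new-letter w max≡j = sumelements-∷ʳ-record w (suc j) (subst (_< suc j) (sym max≡j) (n<1+n j))

  ∑P-sum : ∀ n j → j ≤ K → ∑P n j sum ≡ G n j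
  ∑P-sum zero    zero    _   = refl
  ∑P-sum zero    (suc j) _   = sym (G-empty j)
  ∑P-sum (suc n) zero    _   = ∑P-empty n sum
  ∑P-sum (suc n) (suc j) j<K = begin
    ∑P (suc n) (suc j) sum
      ≡⟨ ∑P-sum-∷ʳ n j j<K ⟩
    suc j * ∑P n (suc j) sum + triangular (suc j) * S n (suc j) + (∑P n j sum + suc j * S n j)
      ≡⟨ cong₂ (λ x y → suc j * x + triangular (suc j) * S n (suc j) + (y + suc j * S n j))
               (∑P-sum n (suc j) j<K) (∑P-sum n j (<⇒≤ j<K)) ⟩
    suc j * G n (suc j) + triangular (suc j) * S n (suc j) + (G n j + suc j * S n j)
      ≡⟨ G-rec n j ⟨
    G (suc n) (suc j) ∎

  ∑P-sumelements : ∀ n j → j ≤ K → ∑P n j sumelements ≡ F n j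
  ∑P-sumelements zero    zero    _   = refl
  ∑P-sumelements zero    (suc j) _   = sym (F-empty j)
  ∑P-sumelements (suc n) zero    _   = ∑P-empty n sumelements
  ∑P-sumelements (suc n) (suc j) j<K = begin
    ∑P (suc n) (suc j) sumelements
      ≡⟨ ∑P-sumelements-∷ʳ n j j<K ⟩
    suc j * ∑P n (suc j) sumelements + (∑P n j sumelements + ∑P n j sum)
      ≡⟨ cong₂ (λ x y → suc j * x + y) (∑P-sumelements n (suc j) j<K)
               (cong₂ _+_ (∑P-sumelements n j (<⇒≤ j<K)) (∑P-sum n j (<⇒≤ j<K))) ⟩
    suc j * F n (suc j) + (F n j + G n j)
      ≡⟨ F-rec n j ⟨
    F (suc n) (suc j) ∎

tetrahedral-as-Σ : ∀ k → tetrahedral k ≡ Σ[1… k ] (λ a → (a * (a ∸ 1)) / 2)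
tetrahedral-as-Σ k = begin
  ∑[ a < k ] triangular a
    ≡⟨ ∑<-cong k (λ a _ → sym (halve (triangular a) (trans (*-comm (suc a) a) (sym (triangular-*2 a))))) ⟩
  ∑[ a < k ] ((suc a * a) / 2)
    ≡⟨ Σ[1…]-as-∑< k (λ a → (a * (a ∸ 1)) / 2) ⟨
  Σ[1… k ] (λ a → (a * (a ∸ 1)) / 2) ∎

half-scaled-triangular : ∀ c i → (c * i * (i + 1)) / 2 ≡ c * triangular i
half-scaled-triangular c i = halve (c * triangular i) (begin
  c * i * (i + 1)          ≡⟨ *-assoc c i (i + 1) ⟩
  c * (i * (i + 1))        ≡⟨ cong (λ z → c * (i * z)) (+-comm i 1) ⟩
  c * (i * suc i)          ≡⟨ cong (c *_) (triangular-*2 i) ⟨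
  c * (triangular i * 2)   ≡⟨ *-assoc c (triangular i) 2 ⟨
  c * triangular i * 2     ∎)

F-as-Σ : ∀ {n m} → suc m ≤ n → F n (suc m)
  ≡ S n (suc m) * Σ[1… suc m ] (λ a → (a * (a ∸ 1)) / 2)
    + Σ[1… m ] (λ i → (((suc m ∸ i) * i * (i + 1)) / 2) * Σ[1… n ∸ suc m ] (λ j → S (n ∸ j) (suc m) * i ^ (j ∸ 1)))
F-as-Σ {n} {m} k≤n = cong₂ _+_ (trans (*-comm (tetrahedral k) (S n k)) (cong (S n k *_) (tetrahedral-as-Σ k))) (begin
  ∑[ a < suc m ] ((m ∸ a) * tH n k (suc a))
    ≡⟨ ∑<-last m (λ a → (m ∸ a) * tH n k (suc a)) ⟩
  ∑[ a < m ] ((m ∸ a) * tH n k (suc a)) + (m ∸ m) * tH n k (suc m)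
    ≡⟨ cong (λ c → ∑[ a < m ] ((m ∸ a) * tH n k (suc a)) + c * tH n k (suc m)) (n∸n≡0 m) ⟩
  ∑[ a < m ] ((m ∸ a) * tH n k (suc a)) + 0
    ≡⟨ +-identityʳ _ ⟩
  ∑[ a < m ] ((m ∸ a) * tH n k (suc a))
    ≡⟨ ∑<-cong m (λ a _ → summand (suc a)) ⟩
  ∑[ a < m ] (((k ∸ suc a) * suc a * (suc a + 1)) / 2 * Σ[1… n ∸ k ] (λ j → S (n ∸ j) k * suc a ^ (j ∸ 1)))
    ≡⟨ Σ[1…]-as-∑< m (λ i → (((k ∸ i) * i * (i + 1)) / 2) * Σ[1… n ∸ k ] (λ j → S (n ∸ j) k * i ^ (j ∸ 1))) ⟨
  Σ[1… m ] (λ i → (((k ∸ i) * i * (i + 1)) / 2) * Σ[1… n ∸ k ] (λ j → S (n ∸ j) k * i ^ (j ∸ 1))) ∎)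
  where
  k = suc m
  summand : ∀ i → (k ∸ i) * tH n k i
                ≡ (((k ∸ i) * i * (i + 1)) / 2) * Σ[1… n ∸ k ] (λ j → S (n ∸ j) k * i ^ (j ∸ 1))
  summand i = trans (sym (*-assoc (k ∸ i) (triangular i) (H n k i)))
                    (cong₂ _*_ (sym (half-scaled-triangular (k ∸ i) i)) (H-as-Σ i k≤n))

theorem2 : (n k : ℕ) → 1 ≤ k → k ≤ n →
    sum (map sumelements (P n k))
      ≡ S n k * Σ[1… k ] (λ a → (a * (a ∸ 1)) / 2)
        + Σ[1… k ∸ 1 ] (λ i → (((k ∸ i) * i * (i + 1)) / 2) * Σ[1… n ∸ k ] (λ j → S (n ∸ j) k * i ^ (j ∸ 1)))
theorem2 n zero    ()
theorem2 n (suc m) _  k≤n = begin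
  sum (map sumelements (P n (suc m)))  ≡⟨ sumMap-filter (isCanonical (suc m)) sumelements (words n (suc m)) ⟩
  ∑P n (suc m) sumelements             ≡⟨ ∑P-sumelements n (suc m) ≤-refl ⟩
  F n (suc m)                          ≡⟨ F-as-Σ k≤n ⟩
  _                                    ∎
  where open CanonicalSums (suc m)
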